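{- Let $x$ and $t$ be positive integers and let $n=\prod_{i=1}^{s}p_i^{k_i}$ be a positive integer, where $p_1,\dots,p_s$ are distinct primes and $k_i\ge 1$, such that $\gcd(\sigma_x(n)+t, n^x)=1$. Suppose there exists an index $1\le j\le s$ such that $p_j^x<\frac{1}{t}\sigma_x\!\left(\frac{n}{p_j^{k_j}}\right)$, and suppose further that $\sigma_x(p_j^{k_j})$ has a divisor of the form $d^x>1$ ($d$ a positive integer) such that at least one of the following holds: (1) $I(x,p_j^{k_j})\,I(x,d)>\frac{\sigma_x(n)+t}{n^x}$ and $\gcd(d^x,t)=1$; or (2) $\gcd(d^x, n^x t)=1$. Then $\frac{\sigma_x(n)+t}{n^x}$ is an $x^{\text{th}}$ abundancy outlaw.
   Context: For positive integers $x,n$, $\sigma_x(n)=\sum_{d\mid n} d^x$ and $I(x,n)=\sigma_x(n)/n^x$. A rational number greater than one is an $x^{\text{th}}$ abundancy outlaw if it is not equal to $I(x,n)$ for any positive integer $n$. -}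

module Defs where

open import Data.Nat using (ℕ; zero; suc; _^_; NonZero)
open import Data.Nat.Divisibility using (_∣?_)
open import Data.List using (List; filter; map; upTo)
open import Data.Nat.ListAction using (sum)
open import Data.Integer using (+_)
open import Data.Rational using (ℚ; _/_; 0ℚ; 1ℚ; _<_)
open import Relation.Binary.PropositionalEquality using (_≢_)
open import Data.Product using (_×_)

divisors : ℕ → List ℕ
divisors n = filter (_∣? n) (map suc (upTo n))

σ : ℕ → ℕ → ℕ
σ x n = sum (map (λ d → d ^ x) (divisors n))

-- the rational a / b  (junk value 0 when b = 0; only used with b > 0)
frac : ℕ → ℕ → ℚ
frac a zero    = 0ℚ
frac a (suc b) = (+ a) / suc b

I : ℕ → ℕ → ℚ
I x n = frac (σ x n) (n ^ x)

IsOutlaw : ℕ → ℚ → Set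
IsOutlaw x q = (1ℚ < q) × ((n : ℕ) → NonZero n → I x n ≢ q)

module Submission where

-- Let A = σ_x(n) + t and B = n^x, so that the rational in question is A/B
-- with gcd(A, B) = 1 and A > B (because σ_x(n) ≥ n^x).  Suppose I(x,N) = A/B.
-- Cross-multiplying, B ∣ A·N^x, hence B ∣ N^x and n ∣ N, say N = L·n with
-- σ_x(Ln) = A·L^x.  Since I(x,-) can only grow when passing to a multiple
-- (σ_x(c·a) ≥ c^x·σ_x(a)), it suffices to exhibit a divisor a of Ln with
-- I(x,a) > A/B (the "outlaw criterion").  The witness is
--   * a = p·n      if p ∣ L   (σ_x(pn) ≥ p^x σ_x(n) + σ_x(m) and σ_x(m) > p^x t);
--   * otherwise d ∣ L (d^x ∣ σ_x(p^k), which divides σ_x(Ln) = A·L^x, and d^x is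
--     coprime to A), and a = p^k·d under hypothesis (1), a = d·n under (2).

open import Defs
open import Data.Nat
open import Data.Nat.Properties
open import Data.Nat.Divisibility
open import Data.Nat.GCD using (gcd; gcd[m,n]∣m; gcd[m,n]∣n; gcd[m,n]≢0)
open import Data.Nat.Coprimality using (Coprime; coprime-divisor; gcd≡1⇒coprime; coprime-/gcd)
import Data.Nat.Coprimality as Coprime
open import Data.Nat.DivMod using (m/n*n≡m)
open import Data.Nat.Primality using (Prime; prime⇒nonZero; prime⇒irreducible; prime⇒nonTrivial; euclidsLemma)
open import Data.Nat.ListAction using (sum)
open import Data.Nat.ListAction.Properties using (sum-++)
open import Data.Nat.Tactic.RingSolver using (solve-∀)
import Data.Integer as ℤ
import Data.Integer.Properties as ℤ
open import Data.Rational as ℚ using (1ℚ; toℚᵘ) renaming (_<_ to _<ℚ_; _*_ to _*ℚ_)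
import Data.Rational.Properties as ℚ
open import Data.Rational.Unnormalised as ℚᵘ using (mkℚᵘ; *≡*; *<*)
import Data.Rational.Unnormalised.Properties as ℚᵘ
open import Data.List using (List; []; _∷_; _++_; map; upTo)
open import Data.List.Properties using (map-++)
open import Data.List.Membership.Propositional using (_∈_)
open import Data.List.Membership.Propositional.Properties
  using (∈-++⁻; ∈-++⁺ˡ; ∈-++⁺ʳ; ∈-∃++; ∈-map⁺; ∈-map⁻; ∈-filter⁺; ∈-filter⁻; ∈-upTo⁺)
open import Data.List.Relation.Binary.Subset.Propositional using (_⊆_)
open import Data.List.Relation.Unary.Any using (here; there)
import Data.List.Relation.Unary.All as All
open import Data.List.Relation.Unary.AllPairs using (_∷_)
open import Data.List.Relation.Unary.Unique.Propositional using (Unique)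
import Data.List.Relation.Unary.Unique.Propositional.Properties as Unique
open import Data.Product using (∃-syntax; _×_; _,_; proj₂)
open import Data.Sum using (_⊎_; inj₁; inj₂)
open import Function using (it; case_of_)
open import Relation.Nullary using (¬_; yes; no; contradiction)
open import Relation.Binary.PropositionalEquality

frac≃ : ∀ a b → toℚᵘ (frac a (suc b)) ℚᵘ.≃ mkℚᵘ (ℤ.+ a) b
frac≃ a b = ℚ.toℚᵘ-fromℚᵘ (mkℚᵘ (ℤ.+ a) b)

+-*-homo : ∀ a b → ℤ.+ a ℤ.* ℤ.+ b ≡ ℤ.+ (a * b)
+-*-homo a b = sym (ℤ.pos-* a b)

frac-cross-≡ : ∀ a b c e → NonZero b → NonZero e → frac a b ≡ frac c e → a * e ≡ c * b
frac-cross-≡ a (suc b) c (suc e) _ _ eq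
  with ℚᵘ.≃-trans (ℚᵘ.≃-sym (frac≃ a b)) (ℚᵘ.≃-trans (ℚᵘ.≃-reflexive (cong toℚᵘ eq)) (frac≃ c e))
... | *≡* ae≡cb = ℤ.+-injective (trans (sym (+-*-homo a (suc e))) (trans ae≡cb (+-*-homo c (suc b))))

frac-cross-< : ∀ a b c e → NonZero b → NonZero e → frac a b <ℚ frac c e → a * e < c * b
frac-cross-< a (suc b) c (suc e) _ _ lt
  with ℚᵘ.<-respˡ-≃ (frac≃ a b) (ℚᵘ.<-respʳ-≃ (frac≃ c e) (ℚ.toℚᵘ-mono-< lt))
... | *<* ae<cb = ℤ.drop‿+<+ (subst₂ ℤ._<_ (+-*-homo a (suc e)) (+-*-homo c (suc b)) ae<cb)

frac-cross-<-* : ∀ a f c b g e → NonZero f → NonZero b → NonZero e →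
  frac a f <ℚ frac c b *ℚ frac g e → a * (b * e) < (c * g) * f
frac-cross-<-* a (suc f) c (suc b) g (suc e) _ _ _ lt
  with ℚᵘ.<-respˡ-≃ (frac≃ a f)
         (ℚᵘ.<-respʳ-≃ (ℚᵘ.≃-trans (ℚ.toℚᵘ-homo-* (frac c (suc b)) (frac g (suc e)))
                                    (ℚᵘ.*-cong (frac≃ c b) (frac≃ g e)))
           (ℚ.toℚᵘ-mono-< lt))
... | *<* lhs<rhs = ℤ.drop‿+<+ (subst₂ ℤ._<_ (+-*-homo a _)
        (trans (cong (ℤ._* ℤ.+ suc f) (+-*-homo c g)) (+-*-homo (c * g) (suc f))) lhs<rhs)

1<frac : ∀ a b .{{_ : NonZero b}} → b < a → 1ℚ <ℚ frac a b
1<frac a (suc b) b<a = ℚ.toℚᵘ-cancel-< (ℚᵘ.<-respʳ-≃ (ℚᵘ.≃-sym (frac≃ a b))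
  (*<* (subst₂ ℤ._<_ (sym (+-*-homo 1 (suc b))) (sym (+-*-homo a 1))
         (ℤ.+<+ (subst₂ _<_ (sym (*-identityˡ (suc b))) (sym (*-identityʳ a)) b<a)))))

^-distribʳ-* : ∀ x a b → (a * b) ^ x ≡ a ^ x * b ^ x
^-distribʳ-* zero    a b = refl
^-distribʳ-* (suc x) a b = begin
  a * b * (a * b) ^ x     ≡⟨ cong (a * b *_) (^-distribʳ-* x a b) ⟩
  a * b * (a ^ x * b ^ x) ≡⟨ [m*n]*[o*p]≡[m*o]*[n*p] a b (a ^ x) (b ^ x) ⟩
  a * a ^ x * (b * b ^ x) ∎
  where open ≡-Reasoning

^-monoˡ-∣ : ∀ x {d n} → d ∣ n → d ^ x ∣ n ^ x
^-monoˡ-∣ x {d} (divides q refl) = divides (q ^ x) (^-distribʳ-* x q d)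

coprime-^ʳ : ∀ {a b} → Coprime a b → ∀ x → Coprime a (b ^ x)
coprime-^ʳ a⊥b zero    (_ , i∣1) = ∣1⇒≡1 i∣1
coprime-^ʳ a⊥b (suc x) (i∣a , i∣bbˣ) =
  coprime-^ʳ a⊥b x (i∣a , coprime-divisor (λ (j∣i , j∣b) → a⊥b (∣-trans j∣i i∣a , j∣b)) i∣bbˣ)

-- Taking x-th roots preserves divisibility: dividing a and b by g = gcd(a,b)
-- leaves coprime a', b' with a'^x ∣ b'^x, forcing a' = 1, i.e. a = g ∣ b.
^-cancel-∣ : ∀ x a b .{{_ : NonZero x}} .{{_ : NonZero a}} → a ^ x ∣ b ^ x → a ∣ b
^-cancel-∣ x@(suc x-1) a b aˣ∣bˣ = subst (_∣ b) (sym a≡g) (gcd[m,n]∣n a b)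
  where
  g = gcd a b
  instance
    g≢0 : NonZero g
    g≢0 = ≢-nonZero (gcd[m,n]≢0 a b (inj₁ (≢-nonZero⁻¹ a)))
    gˣ≢0 : NonZero (g ^ x)
    gˣ≢0 = m^n≢0 g x
  a' = a / g
  b' = b / g
  a'g≡a : a' * g ≡ a
  a'g≡a = m/n*n≡m (gcd[m,n]∣m a b)
  b'g≡b : b' * g ≡ b
  b'g≡b = m/n*n≡m (gcd[m,n]∣n a b)
  a'ˣ∣b'ˣ : a' ^ x ∣ b' ^ x * 1
  a'ˣ∣b'ˣ = subst (a' ^ x ∣_) (sym (*-identityʳ (b' ^ x))) (*-cancelʳ-∣ (g ^ x)
    (subst₂ _∣_ (trans (cong (_^ x) (sym a'g≡a)) (^-distribʳ-* x a' g))
                (trans (cong (_^ x) (sym b'g≡b)) (^-distribʳ-* x b' g)) aˣ∣bˣ))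
  a'ˣ⊥b'ˣ : Coprime (a' ^ x) (b' ^ x)
  a'ˣ⊥b'ˣ = Coprime.sym (coprime-^ʳ (Coprime.sym (coprime-^ʳ (coprime-/gcd a b) x)) x)
  a'≡1 : a' ≡ 1
  a'≡1 = m*n≡1⇒m≡1 a' (a' ^ x-1) (∣1⇒≡1 (coprime-divisor a'ˣ⊥b'ˣ a'ˣ∣b'ˣ))
  a≡g : a ≡ g
  a≡g = trans (sym a'g≡a) (trans (cong (_* g) a'≡1) (*-identityˡ g))

-- A divisor common to d and s + t, where d ∣ s, divides t.
coprime-+ʳ : ∀ {d s t} → d ∣ s → Coprime d t → Coprime d (s + t)
coprime-+ʳ d∣s d⊥t (i∣d , i∣s+t) = d⊥t (i∣d , ∣m+n∣m⇒∣n i∣s+t (∣-trans i∣d d∣s))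

-- Everything divides 0, so a number some p does not divide is non-zero.
∤⇒nonZero : ∀ {p M} → ¬ p ∣ M → NonZero M
∤⇒nonZero {p} {zero}  p∤0 = contradiction (p ∣0) p∤0
∤⇒nonZero {p} {suc M} _   = _

prime∤⇒coprime : ∀ {p v} → Prime p → ¬ p ∣ v → Coprime v p
prime∤⇒coprime pp p∤v (i∣v , i∣p) with prime⇒irreducible pp i∣p
... | inj₁ i≡1 = i≡1
... | inj₂ refl = contradiction i∣v p∤v

prime∤* : ∀ {p a b} → Prime p → ¬ p ∣ a → ¬ p ∣ b → ¬ p ∣ a * b
prime∤* pp p∤a p∤b p∣ab with euclidsLemma _ _ pp p∣ab
... | inj₁ p∣a = p∤a p∣a
... | inj₂ p∣b = p∤b p∣b

prime∤1 : ∀ {p} → Prime p → ¬ p ∣ 1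
prime∤1 {p} pp p∣1 = nonTrivial⇒≢1 {p} {{prime⇒nonTrivial pp}} (∣1⇒≡1 p∣1)

coprime-prime-power : ∀ {p v M} → Prime p → ¬ p ∣ v → ∀ j → v ∣ p ^ j * M → v ∣ M
coprime-prime-power {p} {v} {M} pp p∤v zero    v∣M = subst (v ∣_) (*-identityˡ M) v∣M
coprime-prime-power {p} {v} {M} pp p∤v (suc j) v∣ppʲM = coprime-prime-power pp p∤v j
  (coprime-divisor (prime∤⇒coprime pp p∤v) (subst (v ∣_) (*-assoc p (p ^ j) M) v∣ppʲM))

sum-map-++ : ∀ (f : ℕ → ℕ) xs ys → sum (map f (xs ++ ys)) ≡ sum (map f xs) + sum (map f ys)
sum-map-++ f xs ys = trans (cong sum (map-++ f xs ys)) (sum-++ (map f xs) (map f ys))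

sum-map-extract : ∀ (f : ℕ → ℕ) xs v ys →
  sum (map f (xs ++ v ∷ ys)) ≡ f v + sum (map f (xs ++ ys))
sum-map-extract f xs v ys = begin
  sum (map f (xs ++ v ∷ ys))                  ≡⟨ sum-map-++ f xs (v ∷ ys) ⟩
  sum (map f xs) + (f v + sum (map f ys))     ≡⟨ left-comm (sum (map f xs)) (f v) _ ⟩
  f v + (sum (map f xs) + sum (map f ys))     ≡⟨ cong (f v +_) (sym (sum-map-++ f xs ys)) ⟩
  f v + sum (map f (xs ++ ys))                ∎
  where
  open ≡-Reasoning
  left-comm : ∀ a b c → a + (b + c) ≡ b + (a + c)
  left-comm = solve-∀

sum-map-⊆ : ∀ (f : ℕ → ℕ) {xs ys} → Unique xs → xs ⊆ ys → sum (map f xs) ≤ sum (map f ys)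
sum-map-⊆ f {[]}     _             _      = z≤n
sum-map-⊆ f {v ∷ xs} (v∉xs ∷ uniq) v∷xs⊆ys with ∈-∃++ (v∷xs⊆ys (here refl))
... | ys₁ , ys₂ , refl = begin
  f v + sum (map f xs)            ≤⟨ +-monoʳ-≤ (f v) (sum-map-⊆ f uniq xs⊆ys₁ys₂) ⟩
  f v + sum (map f (ys₁ ++ ys₂))  ≡⟨ sym (sum-map-extract f ys₁ v ys₂) ⟩
  sum (map f (ys₁ ++ v ∷ ys₂))    ∎
  where
  open ≤-Reasoning
  xs⊆ys₁ys₂ : xs ⊆ ys₁ ++ ys₂
  xs⊆ys₁ys₂ {e} e∈xs with ∈-++⁻ ys₁ (v∷xs⊆ys (there e∈xs))
  ... | inj₁ e∈ys₁          = ∈-++⁺ˡ e∈ys₁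
  ... | inj₂ (here refl)    = contradiction refl (All.lookup v∉xs e∈xs)
  ... | inj₂ (there e∈ys₂)  = ∈-++⁺ʳ ys₁ e∈ys₂

power : ℕ → ℕ → ℕ
power x d = d ^ x

divisors-unique : ∀ n → Unique (divisors n)
divisors-unique n = Unique.filter⁺ (_∣? n) (Unique.map⁺ suc-injective (Unique.upTo⁺ n))

∈-divisors⁻ : ∀ {e n} → e ∈ divisors n → e ∣ n
∈-divisors⁻ {n = n} e∈ = proj₂ (∈-filter⁻ (_∣? n) {xs = map suc (upTo n)} e∈)

∈-divisors⁺ : ∀ {e n} .{{_ : NonZero n}} → e ∣ n → e ∈ divisors n
∈-divisors⁺ {zero}  {n} 0∣n with () ← ≢-nonZero⁻¹ n (0∣⇒≡0 0∣n)
∈-divisors⁺ {suc e} {n} e∣n = ∈-filter⁺ (_∣? n) (∈-map⁺ suc (∈-upTo⁺ (∣⇒≤ e∣n))) e∣n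

σ-1 : ∀ x → σ x 1 ≡ 1
σ-1 x = trans (+-identityʳ (1 ^ x)) (^-zeroˡ x)

sum-power-scaled : ∀ x c xs → sum (map (power x) (map (c *_) xs)) ≡ c ^ x * sum (map (power x) xs)
sum-power-scaled x c []       = sym (*-zeroʳ (c ^ x))
sum-power-scaled x c (e ∷ xs) = trans (cong₂ _+_ (^-distribʳ-* x c e) (sum-power-scaled x c xs))
                                      (sym (*-distribˡ-+ (c ^ x) (e ^ x) _))

scaled-divisors : ℕ → ℕ → List ℕ
scaled-divisors c a = map (c *_) (divisors a)

scaled-divisors-unique : ∀ c a .{{_ : NonZero c}} → Unique (scaled-divisors c a)
scaled-divisors-unique c a = Unique.map⁺ (*-cancelˡ-≡ _ _ c) (divisors-unique a)

scaled-divisors-⊆ : ∀ c a .{{_ : NonZero (c * a)}} → scaled-divisors c a ⊆ divisors (c * a)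
scaled-divisors-⊆ c a v∈ with ∈-map⁻ (c *_) v∈
... | e , e∈ , refl = ∈-divisors⁺ (*-monoʳ-∣ c (∈-divisors⁻ e∈))

σ-scaled : ∀ x c a → sum (map (power x) (scaled-divisors c a)) ≡ c ^ x * σ x a
σ-scaled x c a = sum-power-scaled x c (divisors a)

σ-≥-scaled : ∀ x c a .{{_ : NonZero c}} .{{_ : NonZero a}} → c ^ x * σ x a ≤ σ x (c * a)
σ-≥-scaled x c a = subst (_≤ σ x (c * a)) (σ-scaled x c a)
  (sum-map-⊆ (power x) (scaled-divisors-unique c a) (scaled-divisors-⊆ c a {{m*n≢0 c a}}))

σ-≥-self : ∀ x n .{{_ : NonZero n}} → n ^ x ≤ σ x n
σ-≥-self x n = subst₂ _≤_ (trans (cong (n ^ x *_) (σ-1 x)) (*-identityʳ (n ^ x)))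
                          (cong (σ x) (*-identityʳ n)) (σ-≥-scaled x n 1)

σ-nonZero : ∀ x n .{{_ : NonZero n}} → NonZero (σ x n)
σ-nonZero x n = >-nonZero (<-≤-trans (m^n>0 n x) (σ-≥-self x n))

-- When b ∣ a and c ∤ b, the divisors of b are divisors of c·a disjoint from the
-- multiples c·e (e ∣ a), so σ_x(c·a) ≥ c^x·σ_x(a) + σ_x(b).
σ-≥-two-blocks : ∀ x {c a b} .{{_ : NonZero c}} .{{_ : NonZero a}} → ¬ c ∣ b → b ∣ a →
  c ^ x * σ x a + σ x b ≤ σ x (c * a)
σ-≥-two-blocks x {c} {a} {b} c∤b b∣a = subst (_≤ σ x (c * a)) sum-blocks
  (sum-map-⊆ (power x) (Unique.++⁺ (scaled-divisors-unique c a) (divisors-unique b) disjoint) blocks⊆)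
  where
  instance
    ca≢0 : NonZero (c * a)
    ca≢0 = m*n≢0 c a
  sum-blocks : sum (map (power x) (scaled-divisors c a ++ divisors b)) ≡ c ^ x * σ x a + σ x b
  sum-blocks = trans (sum-map-++ (power x) (scaled-divisors c a) (divisors b))
                     (cong (_+ σ x b) (σ-scaled x c a))
  disjoint : ∀ {v} → ¬ (v ∈ scaled-divisors c a × v ∈ divisors b)
  disjoint (v∈ , v∈b) with ∈-map⁻ (c *_) v∈
  ... | e , _ , refl = c∤b (∣-trans (m∣m*n e) (∈-divisors⁻ v∈b))
  blocks⊆ : scaled-divisors c a ++ divisors b ⊆ divisors (c * a)
  blocks⊆ v∈ with ∈-++⁻ (scaled-divisors c a) v∈
  ... | inj₁ v∈ca = scaled-divisors-⊆ c a v∈ca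
  ... | inj₂ v∈b  = ∈-divisors⁺ (∣n⇒∣m*n c (∣-trans (∈-divisors⁻ v∈b) b∣a))

-- Each divisor v of p·(p^k·M), p ∤ M, is either p·w with w ∣ p^k·M, or prime to p
-- and then a divisor of M; hence the reverse of the two-block bound holds too.
σ-≤-prime-split : ∀ x {p M} → Prime p → ¬ p ∣ M → ∀ k →
  σ x (p * (p ^ k * M)) ≤ p ^ x * σ x (p ^ k * M) + σ x M
σ-≤-prime-split x {p} {M} pp p∤M k = subst (σ x (p * K) ≤_) sum-blocks
  (sum-map-⊆ (power x) (divisors-unique (p * K)) split)
  where
  K = p ^ k * M
  instance
    p≢0 : NonZero p
    p≢0 = prime⇒nonZero pp
    M≢0 : NonZero M
    M≢0 = ∤⇒nonZero p∤M
    K≢0 : NonZero K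
    K≢0 = m*n≢0 (p ^ k) M {{m^n≢0 p k}}
  sum-blocks : sum (map (power x) (scaled-divisors p K ++ divisors M)) ≡ p ^ x * σ x K + σ x M
  sum-blocks = trans (sum-map-++ (power x) (scaled-divisors p K) (divisors M))
                     (cong (_+ σ x M) (σ-scaled x p K))
  split : divisors (p * K) ⊆ scaled-divisors p K ++ divisors M
  split {v} v∈ with p ∣? v | ∈-divisors⁻ v∈
  ... | yes (divides w refl) | wp∣pK = ∈-++⁺ˡ (subst (_∈ scaled-divisors p K) (*-comm p w)
          (∈-map⁺ (p *_) (∈-divisors⁺ (*-cancelˡ-∣ p (subst (_∣ p * K) (*-comm w p) wp∣pK)))))
  ... | no p∤v | v∣pK = ∈-++⁺ʳ (scaled-divisors p K)
          (∈-divisors⁺ (coprime-prime-power pp p∤v (suc k) (subst (v ∣_) (sym (*-assoc p (p ^ k) M)) v∣pK)))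

σ-prime-step : ∀ x {p M} → Prime p → ¬ p ∣ M → ∀ k →
  σ x (p * (p ^ k * M)) ≡ p ^ x * σ x (p ^ k * M) + σ x M
σ-prime-step x {p} {M} pp p∤M k =
  ≤-antisym (σ-≤-prime-split x pp p∤M k) (σ-≥-two-blocks x p∤M (n∣m*n (p ^ k)))
  where
  instance
    p≢0 : NonZero p
    p≢0 = prime⇒nonZero pp
    pᵏM≢0 : NonZero (p ^ k * M)
    pᵏM≢0 = m*n≢0 (p ^ k) M {{m^n≢0 p k}} {{∤⇒nonZero p∤M}}

σ-prime-power-mult : ∀ x {p M} → Prime p → ¬ p ∣ M → ∀ k → σ x (p ^ k * M) ≡ σ x (p ^ k) * σ x M
σ-prime-power-mult x {p} {M} pp p∤M zero = begin
  σ x (1 * M)     ≡⟨ cong (σ x) (*-identityˡ M) ⟩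
  σ x M           ≡⟨ sym (*-identityˡ (σ x M)) ⟩
  1 * σ x M       ≡⟨ cong (_* σ x M) (sym (σ-1 x)) ⟩
  σ x 1 * σ x M   ∎
  where open ≡-Reasoning
σ-prime-power-mult x {p} {M} pp p∤M (suc k) = begin
  σ x (p * p ^ k * M)                 ≡⟨ cong (σ x) (*-assoc p (p ^ k) M) ⟩
  σ x (p * (p ^ k * M))               ≡⟨ σ-prime-step x pp p∤M k ⟩
  p ^ x * σ x (p ^ k * M) + σ x M     ≡⟨ cong (λ z → p ^ x * z + σ x M) (σ-prime-power-mult x pp p∤M k) ⟩
  p ^ x * (s * σ x M) + σ x M         ≡⟨ factor (p ^ x) s (σ x M) ⟩
  (p ^ x * s + 1) * σ x M             ≡⟨ cong (_* σ x M) (sym σ-ppᵏ) ⟩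
  σ x (p * p ^ k) * σ x M             ∎
  where
  open ≡-Reasoning
  s = σ x (p ^ k)
  factor : ∀ P S T → P * (S * T) + T ≡ (P * S + 1) * T
  factor = solve-∀
  σ-ppᵏ : σ x (p * p ^ k) ≡ p ^ x * s + 1
  σ-ppᵏ = begin
    σ x (p * p ^ k)                   ≡⟨ cong (λ z → σ x (p * z)) (sym (*-identityʳ (p ^ k))) ⟩
    σ x (p * (p ^ k * 1))             ≡⟨ σ-prime-step x pp (prime∤1 pp) k ⟩
    p ^ x * σ x (p ^ k * 1) + σ x 1   ≡⟨ cong₂ (λ a b → p ^ x * σ x a + b) (*-identityʳ (p ^ k)) (σ-1 x) ⟩
    p ^ x * s + 1                     ∎

ExceedingDivisor : ℕ → ℕ → ℕ → ℕ → Set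
ExceedingDivisor x A B N = ∃[ a ] a ∣ N × A * a ^ x < σ x a * B

-- Since σ_x(c·a) ≥ c^x·σ_x(a), i.e. I(x,c·a) ≥ I(x,a), an exceeding divisor of N
-- rules out I(x,N) = A / B.
exceeding-divisor⇒≢ : ∀ x A B N .{{_ : NonZero N}} → ExceedingDivisor x A B N → σ x N * B ≢ A * N ^ x
exceeding-divisor⇒≢ x A B N (a , divides c refl , exceeds) σN*B≡A*Nˣ = <-irrefl refl (begin-strict
  c ^ x * (A * a ^ x)   <⟨ *-monoʳ-< (c ^ x) exceeds ⟩
  c ^ x * (σ x a * B)   ≡⟨ *-assoc (c ^ x) (σ x a) B ⟨
  c ^ x * σ x a * B     ≤⟨ *-monoˡ-≤ B (σ-≥-scaled x c a) ⟩
  σ x (c * a) * B       ≡⟨ σN*B≡A*Nˣ ⟩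
  A * (c * a) ^ x       ≡⟨ cong (A *_) (^-distribʳ-* x c a) ⟩
  A * (c ^ x * a ^ x)   ≡⟨ left-comm A (c ^ x) (a ^ x) ⟩
  c ^ x * (A * a ^ x)   ∎)
  where
  open ≤-Reasoning
  instance
    c≢0 : NonZero c
    c≢0 = m*n≢0⇒m≢0 c
    a≢0 : NonZero a
    a≢0 = m*n≢0⇒n≢0 c
    cˣ≢0 : NonZero (c ^ x)
    cˣ≢0 = m^n≢0 c x
  left-comm : ∀ A C X → A * (C * X) ≡ C * (A * X)
  left-comm = solve-∀

-- If A is coprime to n^x, a solution of σ_x(N)·n^x = A·N^x has n^x ∣ N^x, so n ∣ N.
solution-multiple : ∀ x A n N .{{_ : NonZero x}} .{{_ : NonZero n}} → Coprime A (n ^ x) →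
  σ x N * n ^ x ≡ A * N ^ x → n ∣ N
solution-multiple x A n N A⊥nˣ eq =
  ^-cancel-∣ x n N (coprime-divisor (Coprime.sym A⊥nˣ) (divides (σ x N) (sym eq)))

-- A / n^x, coprime and greater than 1, is an outlaw as soon as every candidate
-- N = L·n (the only possible form, with σ_x(L·n) = A·L^x) has an exceeding divisor.
outlaw-criterion : ∀ x A n .{{_ : NonZero x}} .{{_ : NonZero n}} → Coprime A (n ^ x) → n ^ x < A →
  (∀ L .{{_ : NonZero L}} → σ x (L * n) ≡ A * L ^ x → ExceedingDivisor x A (n ^ x) (L * n)) →
  IsOutlaw x (frac A (n ^ x))
outlaw-criterion x A n A⊥nˣ nˣ<A exceeding-divisor =
  1<frac A (n ^ x) {{m^n≢0 n x}} nˣ<A , no-solution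
  where
  no-multiple-solution : ∀ N .{{_ : NonZero N}} → n ∣ N → σ x N * n ^ x ≢ A * N ^ x
  no-multiple-solution N (divides L refl) eq =
    exceeding-divisor⇒≢ x A (n ^ x) (L * n) (exceeding-divisor L σLn) eq
    where
    instance
      L≢0 : NonZero L
      L≢0 = m*n≢0⇒m≢0 L
    σLn : σ x (L * n) ≡ A * L ^ x
    σLn = *-cancelʳ-≡ _ _ (n ^ x) {{m^n≢0 n x}} (begin
      σ x (L * n) * n ^ x   ≡⟨ eq ⟩
      A * (L * n) ^ x       ≡⟨ cong (A *_) (^-distribʳ-* x L n) ⟩
      A * (L ^ x * n ^ x)   ≡⟨ *-assoc A (L ^ x) (n ^ x) ⟨
      A * L ^ x * n ^ x     ∎)
      where open ≡-Reasoning
  no-solution : ∀ N → NonZero N → I x N ≢ frac A (n ^ x)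
  no-solution N N≢0 I≡ = no-multiple-solution N {{N≢0}} (solution-multiple x A n N A⊥nˣ cross) cross
    where
    cross : σ x N * n ^ x ≡ A * N ^ x
    cross = frac-cross-≡ (σ x N) (N ^ x) A (n ^ x) (m^n≢0 N x {{N≢0}}) (m^n≢0 n x) I≡

scaled-exceeds : ∀ x c a t s .{{_ : NonZero a}} → c ^ x * t < s → c ^ x * σ x a + s ≤ σ x (c * a) →
  (σ x a + t) * (c * a) ^ x < σ x (c * a) * a ^ x
scaled-exceeds x c a t s cˣt<s lower = begin-strict
  (σ x a + t) * (c * a) ^ x           ≡⟨ cong ((σ x a + t) *_) (^-distribʳ-* x c a) ⟩
  (σ x a + t) * (c ^ x * a ^ x)       ≡⟨ distribute (σ x a) t (c ^ x) (a ^ x) ⟩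
  (c ^ x * σ x a + c ^ x * t) * a ^ x <⟨ *-monoˡ-< (a ^ x) {{m^n≢0 a x}} (+-monoʳ-< (c ^ x * σ x a) cˣt<s) ⟩
  (c ^ x * σ x a + s) * a ^ x         ≤⟨ *-monoˡ-≤ (a ^ x) lower ⟩
  σ x (c * a) * a ^ x                 ∎
  where
  open ≤-Reasoning
  distribute : ∀ S T C X → (S + T) * (C * X) ≡ (C * S + C * T) * X
  distribute = solve-∀

-- For p ∤ d, I(x,p^k)·I(x,d) = I(x,p^k·d), so I(x,p^k)·I(x,d) > A / B says p^k·d exceeds A / B.
prime-power-product-exceeds : ∀ x A B {p} k d {{_ : NonZero B}} .{{_ : NonZero d}} → Prime p → ¬ p ∣ d →
  frac A B <ℚ I x (p ^ k) *ℚ I x d → A * (p ^ k * d) ^ x < σ x (p ^ k * d) * B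
prime-power-product-exceeds x A B {p} k d pp p∤d lt = subst₂ _<_
  (cong (A *_) (sym (^-distribʳ-* x (p ^ k) d)))
  (cong (_* B) (sym (σ-prime-power-mult x pp p∤d k)))
  (frac-cross-<-* A B (σ x (p ^ k)) ((p ^ k) ^ x) (σ x d) (d ^ x) it pᵏˣ≢0 (m^n≢0 d x) lt)
  where
  pᵏˣ≢0 : NonZero ((p ^ k) ^ x)
  pᵏˣ≢0 = m^n≢0 (p ^ k) x {{m^n≢0 p k {{prime⇒nonZero pp}}}}

-- If p ∤ L then L·n = p^k·(m·L) with p ∤ m·L, so d^x ∣ σ_x(p^k) divides
-- σ_x(L·n) = A·L^x; when d^x is coprime to A this gives d^x ∣ L^x, i.e. d ∣ L.
divisor-of-cofactor : ∀ x {p k m n} L A d .{{_ : NonZero x}} .{{_ : NonZero d}} →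
  Prime p → ¬ p ∣ m → ¬ p ∣ L → n ≡ p ^ k * m →
  σ x (L * n) ≡ A * L ^ x → d ^ x ∣ σ x (p ^ k) → Coprime (d ^ x) A → d ∣ L
divisor-of-cofactor x {p} {k} {m} {n} L A d pp p∤m p∤L n≡pᵏm σLn dˣ∣σpᵏ dˣ⊥A =
  ^-cancel-∣ x d L (coprime-divisor dˣ⊥A (subst (d ^ x ∣_) σ-factorisation (∣m⇒∣m*n _ dˣ∣σpᵏ)))
  where
  σ-factorisation : σ x (p ^ k) * σ x (m * L) ≡ A * L ^ x
  σ-factorisation = begin
    σ x (p ^ k) * σ x (m * L)   ≡⟨ σ-prime-power-mult x pp (prime∤* pp p∤m p∤L) k ⟨
    σ x (p ^ k * (m * L))       ≡⟨ cong (σ x) (rearrange L (p ^ k) m) ⟩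
    σ x (L * (p ^ k * m))       ≡⟨ cong (λ z → σ x (L * z)) n≡pᵏm ⟨
    σ x (L * n)                 ≡⟨ σLn ⟩
    A * L ^ x                   ∎
    where
    open ≡-Reasoning
    rearrange : ∀ L P M → P * (M * L) ≡ L * (P * M)
    rearrange = solve-∀

coprime-power⇒∤ : ∀ x {d n} t → 1 < d ^ x → Coprime (d ^ x) (n ^ x * t) → ¬ d ∣ n
coprime-power⇒∤ x t 1<dˣ dˣ⊥nˣt d∣n =
  <-irrefl (sym (dˣ⊥nˣt (∣-refl , ∣m⇒∣m*n t (^-monoˡ-∣ x d∣n)))) 1<dˣ

coprime-*ʳ⇒coprime : ∀ {a b c} → Coprime a (b * c) → Coprime a c
coprime-*ʳ⇒coprime {b = b} a⊥bc (i∣a , i∣c) = a⊥bc (i∣a , ∣n⇒∣m*n b i∣c)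

∣-*-< : ∀ {c b t s} .{{_ : NonZero c}} .{{_ : NonZero b}} → c ∣ b → t < s → c * t < b * s
∣-*-< {c} {b} {t} {s} c∣b t<s = <-≤-trans (*-monoʳ-< c t<s) (*-monoˡ-≤ s (∣⇒≤ c∣b))

mainTheorem2 : (x t n : ℕ) → NonZero x → NonZero t → NonZero n →
    gcd (σ x n + t) (n ^ x) ≡ 1 →
    (p k m : ℕ) → Prime p → NonZero k → n ≡ p ^ k * m → ¬ (p ∣ m) →
    frac (p ^ x) 1 <ℚ frac (σ x m) t →
    (d : ℕ) → NonZero d → 1 < d ^ x → d ^ x ∣ σ x (p ^ k) →
    ((frac (σ x n + t) (n ^ x) <ℚ (I x (p ^ k) *ℚ I x d))
        × gcd (d ^ x) t ≡ 1)
      ⊎ (gcd (d ^ x) (n ^ x * t) ≡ 1) →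
    IsOutlaw x (frac (σ x n + t) (n ^ x))
mainTheorem2 x t n x≢0 t≢0 n≢0 gcd≡1 p k m pp _ n≡pᵏm p∤m pˣ<σm/t d d≢0 1<dˣ dˣ∣σpᵏ hypothesis =
  outlaw-criterion x A n (gcd≡1⇒coprime gcd≡1) (≤-<-trans (σ-≥-self x n) (m<m+n _ (>-nonZero⁻¹ t)))
    exceeding-divisor
  where
  instance
    _ = x≢0 ; _ = t≢0 ; _ = n≢0 ; _ = d≢0 ; _ = m^n≢0 n x ; _ = m^n≢0 d x
    _ = prime⇒nonZero pp ; _ = m^n≢0 p k ; _ = m^n≢0 p x ; _ = ∤⇒nonZero p∤m
  A = σ x n + t
  pᵏ∣n : p ^ k ∣ n
  pᵏ∣n = subst (p ^ k ∣_) (sym n≡pᵏm) (m∣m*n m)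
  m∣n : m ∣ n
  m∣n = subst (m ∣_) (sym n≡pᵏm) (n∣m*n (p ^ k))
  σn≡ : σ x n ≡ σ x (p ^ k) * σ x m
  σn≡ = trans (cong (σ x) n≡pᵏm) (σ-prime-power-mult x pp p∤m k)
  pˣt<σm : p ^ x * t < σ x m
  pˣt<σm = subst (p ^ x * t <_) (*-identityʳ (σ x m)) (frac-cross-< (p ^ x) 1 (σ x m) t _ t≢0 pˣ<σm/t)
  dˣt<σn : d ^ x * t < σ x n
  dˣt<σn = subst (d ^ x * t <_) (sym σn≡) (∣-*-< {{m^n≢0 d x}} {{σ-nonZero x (p ^ k)}} dˣ∣σpᵏ
    (≤-<-trans (m≤n*m t (p ^ x)) pˣt<σm))
  dˣ⊥t : Coprime (d ^ x) t
  dˣ⊥t = case hypothesis of λ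
    { (inj₁ (_ , gcd[dˣ,t]≡1)) → gcd≡1⇒coprime gcd[dˣ,t]≡1
    ; (inj₂ gcd[dˣ,nˣt]≡1)     → coprime-*ʳ⇒coprime {b = n ^ x} (gcd≡1⇒coprime gcd[dˣ,nˣt]≡1) }
  exceeding-divisor : ∀ L .{{_ : NonZero L}} → σ x (L * n) ≡ A * L ^ x → ExceedingDivisor x A (n ^ x) (L * n)
  exceeding-divisor L σLn with p ∣? L
  ... | yes p∣L = p * n , *-monoˡ-∣ n p∣L ,
    scaled-exceeds x p n t (σ x m) pˣt<σm (σ-≥-two-blocks x p∤m m∣n)
  ... | no p∤L = case hypothesis of λ
    { (inj₁ (I-product>A/B , _)) → p ^ k * d , subst (p ^ k * d ∣_) (*-comm n L) (*-pres-∣ pᵏ∣n d∣L) ,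
        prime-power-product-exceeds x A (n ^ x) k d pp (λ p∣d → p∤L (∣-trans p∣d d∣L)) I-product>A/B
    ; (inj₂ gcd[dˣ,nˣt]≡1) → d * n , *-monoˡ-∣ n d∣L , scaled-exceeds x d n t (σ x n) dˣt<σn
        (σ-≥-two-blocks x (coprime-power⇒∤ x {n = n} t 1<dˣ (gcd≡1⇒coprime gcd[dˣ,nˣt]≡1)) ∣-refl) }
    where
    dˣ⊥A : Coprime (d ^ x) A
    dˣ⊥A = coprime-+ʳ (subst (d ^ x ∣_) (sym σn≡) (∣m⇒∣m*n (σ x m) dˣ∣σpᵏ)) dˣ⊥t
    d∣L : d ∣ L
    d∣L = divisor-of-cofactor x {k = k} L A d pp p∤m p∤L n≡pᵏm σLn dˣ∣σpᵏ dˣ⊥A
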